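{- Let $i$ be a positive integer with $\gcd(m,i)=1$, let $L,L':\mathbb{F}_{2^m}\to\mathbb{F}_{2^m}$ be $\mathbb{F}_2$-linear, and let $F(x)=L(x^{2^i+1})+L'(x)$. Then $F$ is a permutation of $\mathbb{F}_{2^m}$ if and only if for every $u\in\mathbb{F}_{2^m}\setminus\{0\}$ and every $v\in\mathbb{F}_{2^m}$ with $tr(v)=tr(1)$ one has $L(u^{2^i+1}v)\neq L'(u)$.
   Context: $tr(x)=x+x^2+\dots+x^{2^{m-1}}$ is the absolute trace from $\mathbb{F}_{2^m}$ to $\mathbb{F}_2$. -}

module Defs where

open import Level using (0ℓ)
open import Data.Nat using (ℕ; zero; suc; _^_)
open import Data.Fin using (Fin)
open import Data.Product using (∃)
open import Relation.Nullary using (¬_)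
open import Relation.Binary.PropositionalEquality as ≡ using (_≡_)
open import Algebra.Bundles using (CommutativeRing)
open import Function.Bundles using (Bijection)

-- A finite field with exactly 2^m elements (unique up to isomorphism, so
-- quantifying over all of them is the same as speaking of "the" F_{2^m}).
record GF2^ (m : ℕ) : Set₁ where
  field
    commRing    : CommutativeRing 0ℓ 0ℓ
  open CommutativeRing commRing public
  field
    nontrivial  : ¬ (0# ≈ 1#)
    inverse     : ∀ x → ¬ (x ≈ 0#) → ∃ λ y → (x * y) ≈ 1#
    cardinality : Bijection (≡.setoid (Fin (2 ^ m))) setoid

module _ {m : ℕ} (K : GF2^ m) where
  open GF2^ K

  pow : Carrier → ℕ → Carrier
  pow x zero    = 1#
  pow x (suc n) = x * pow x n

  trSum : ℕ → Carrier → Carrier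
  trSum zero    x = 0#
  trSum (suc n) x = trSum n x + pow x (2 ^ n)

  tr : Carrier → Carrier
  tr = trSum m

  -- F_2-linear map K → K (respecting the field's equality).  Over F_2,
  -- scalar compatibility reduces to additivity (0·x = 0 follows from it).
  record F2Linear (f : Carrier → Carrier) : Set where
    field
      cong     : ∀ {x y} → x ≈ y → f x ≈ f y
      additive : ∀ x y → f (x + y) ≈ (f x + f y)

-- Put ℘ w = w^(2^i) + w. Because x ↦ x^(2^i+1) is a quadratic form over F₂,
--   F(u w + u) + F(u w) = L(u^(2^i+1) (℘ w + 1)) + L′(u),
-- so F has a collision F(x) = F(y), x ≠ y, exactly when the displayed right-hand side
-- vanishes for u = x + y ≠ 0 and some w. As gcd(m, i) = 1 the F₂-linear map ℘ has
-- kernel {0, 1}, so its image has 2^(m-1) elements; it lies in the hyperplane tr = 0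
-- because tr(w^(2^i)) = tr(w), and tr is not identically zero (it is a polynomial of
-- degree 2^(m-1) < 2^m), so the image is that hyperplane. Hence ℘ w + 1 ranges over
-- the v with tr(v) = tr(1), and F is injective, i.e. bijective, iff the condition holds.

module Submission where

open import Defs
open import Level using (_⊔_)
open import Algebra.Bundles using (CommutativeRing; CommutativeSemiring; Semiring)
open import Data.Bool using (if_then_else_)
open import Data.Empty using (⊥-elim)
open import Data.Fin as Fin using (Fin)
import Data.Fin.Properties as Finₚ
import Data.Nat as ℕ
import Data.Nat.Properties as ℕₚ
open import Data.Nat.GCD using (gcd; gcd-GCD; module Bézout)
open import Data.Product using (∃; _,_; _×_; proj₁; proj₂)
open import Data.Sum using (_⊎_; inj₁; inj₂)
open import Function.Bundles using (Bijection; _⇔_; mk⇔)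
open import Function.Definitions using (Congruent; Injective; Surjective; Bijective)
open import Relation.Binary.Definitions using (tri<; tri≈; tri>)
open import Relation.Binary.PropositionalEquality as ≡ using (_≡_; _≢_)
open import Relation.Nullary using (¬_; Dec; does; yes; no)

Fin-injective⇒surjective : ∀ {n} (f : Fin n → Fin n) →
                           Injective _≡_ _≡_ f → Surjective _≡_ _≡_ f
Fin-injective⇒surjective {ℕ.suc n} f f-inj y with Finₚ.any? (λ x → f x Fin.≟ y)
... | yes (x , fx≡y) = x , λ { ≡.refl → fx≡y }
... | no y∉image = ⊥-elim (Finₚ.<⇒notInjective (ℕₚ.n<1+n n) punchOut∘f-injective)
  where
  y≢f : ∀ x → y ≢ f x
  y≢f x y≡fx = y∉image (x , ≡.sym y≡fx)

  punchOut∘f-injective : Injective _≡_ _≡_ (λ x → Fin.punchOut (y≢f x))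
  punchOut∘f-injective eq = f-inj (Finₚ.punchOut-injective (y≢f _) (y≢f _) eq)

module Characteristic {a ℓ} (R : CommutativeRing a ℓ) where
  open CommutativeRing R
  open import Algebra.Definitions.RawSemiring (Semiring.rawSemiring semiring) using (_^_)
  open import Algebra.Properties.Semiring.Exp semiring using (^-congˡ; ^-assocʳ)
  open import Algebra.Solver.Ring.NaturalCoefficients.Default commutativeSemiring
  open import Relation.Binary.Reasoning.Setoid setoid

  module Two (1+1≈0 : 1# + 1# ≈ 0#) where

    x+x≈0 : ∀ x → x + x ≈ 0#
    x+x≈0 x = begin
      x + x             ≈⟨ +-cong (*-identityʳ x) (*-identityʳ x) ⟨
      x * 1# + x * 1#   ≈⟨ distribˡ x 1# 1# ⟨
      x * (1# + 1#)     ≈⟨ *-congˡ 1+1≈0 ⟩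
      x * 0#            ≈⟨ zeroʳ x ⟩
      0#                ∎

    x+y+y≈x : ∀ x y → x + y + y ≈ x
    x+y+y≈x x y = trans (+-assoc x y y) (trans (+-congˡ (x+x≈0 y)) (+-identityʳ x))

    x+y≈0⇒x≈y : ∀ {x y} → x + y ≈ 0# → x ≈ y
    x+y≈0⇒x≈y {x} {y} x+y≈0 = trans (sym (x+y+y≈x x y)) (trans (+-congʳ x+y≈0) (+-identityˡ y))

    x≈y⇒x+y≈0 : ∀ {x y} → x ≈ y → x + y ≈ 0#
    x≈y⇒x+y≈0 {x} {y} x≈y = trans (+-congʳ x≈y) (x+x≈0 y)

    square-distrib-+ : ∀ x y → (x + y) ^ 2 ≈ x ^ 2 + y ^ 2
    square-distrib-+ x y = begin
      (x + y) ^ 2                     ≈⟨ solve 2 (λ x y → (x :+ y) :^ 2 := x :^ 2 :+ y :^ 2 :+ (x :* y :+ x :* y))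
                                                 refl x y ⟩
      x ^ 2 + y ^ 2 + (x * y + x * y) ≈⟨ +-congˡ (x+x≈0 (x * y)) ⟩
      x ^ 2 + y ^ 2 + 0#              ≈⟨ +-identityʳ _ ⟩
      x ^ 2 + y ^ 2                   ∎

    frobenius-+ : ∀ k x y → (x + y) ^ (2 ℕ.^ k) ≈ x ^ (2 ℕ.^ k) + y ^ (2 ℕ.^ k)
    frobenius-+ ℕ.zero    x y = solve 2 (λ x y → (x :+ y) :^ 1 := x :^ 1 :+ y :^ 1) refl x y
    frobenius-+ (ℕ.suc k) x y = begin
      (x + y) ^ (2 ℕ.* 2 ℕ.^ k)                   ≈⟨ ^-assocʳ (x + y) 2 (2 ℕ.^ k) ⟨
      ((x + y) ^ 2) ^ (2 ℕ.^ k)                   ≈⟨ ^-congˡ (2 ℕ.^ k) (square-distrib-+ x y) ⟩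
      (x ^ 2 + y ^ 2) ^ (2 ℕ.^ k)                 ≈⟨ frobenius-+ k (x ^ 2) (y ^ 2) ⟩
      (x ^ 2) ^ (2 ℕ.^ k) + (y ^ 2) ^ (2 ℕ.^ k)   ≈⟨ +-cong (^-assocʳ x 2 (2 ℕ.^ k)) (^-assocʳ y 2 (2 ℕ.^ k)) ⟩
      x ^ (2 ℕ.* 2 ℕ.^ k) + y ^ (2 ℕ.* 2 ℕ.^ k)   ∎

module Polynomial {a ℓ} (R : CommutativeSemiring a ℓ) where
  open CommutativeSemiring R
  open import Algebra.Definitions.RawSemiring (Semiring.rawSemiring semiring) using (_^_)
  open import Algebra.Solver.Ring.NaturalCoefficients.Default R using (solve; _:=_; _:+_; _:*_)
  open import Relation.Binary.Reasoning.Setoid setoid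

  -- Polynomial n c f: f is a polynomial function of degree at most n whose
  -- coefficient of x^n is c (which may be 0).
  data Polynomial : ℕ.ℕ → Carrier → (Carrier → Carrier) → Set (a ⊔ ℓ) where
    constant : ∀ {c f} → (∀ x → f x ≈ c) → Polynomial 0 c f
    horner   : ∀ {n c f} b g → Polynomial n c g → (∀ x → f x ≈ b + x * g x) →
               Polynomial (ℕ.suc n) c f

  Polynomial-cong : ∀ {n c f g} → (∀ x → f x ≈ g x) → Polynomial n c f → Polynomial n c g
  Polynomial-cong f≈g (constant f≈c)      = constant (λ x → trans (sym (f≈g x)) (f≈c x))
  Polynomial-cong f≈g (horner b h ph f≈h) = horner b h ph (λ x → trans (sym (f≈g x)) (f≈h x))

  raise : ∀ {n c f} → Polynomial n c f → Polynomial (ℕ.suc n) 0# f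
  raise {c = c} (constant f≈c) =
    horner c (λ _ → 0#) (constant (λ _ → refl))
      (λ x → trans (f≈c x) (sym (trans (+-congˡ (zeroʳ x)) (+-identityʳ c))))
  raise (horner b g pg f≈g) = horner b g (raise pg) f≈g

  raise-≤′ : ∀ {n n′ f} → n ℕ.≤′ n′ → Polynomial n 0# f → Polynomial n′ 0# f
  raise-≤′ ℕ.≤′-refl        p = p
  raise-≤′ (ℕ.≤′-step n≤n′) p = raise (raise-≤′ n≤n′ p)

  ^-polynomial : ∀ k → Polynomial k 1# (_^ k)
  ^-polynomial ℕ.zero    = constant (λ _ → refl)
  ^-polynomial (ℕ.suc k) = horner 0# (_^ k) (^-polynomial k) (λ _ → sym (+-identityˡ _))

  +-polynomial : ∀ {n c d f g} → Polynomial n c f → Polynomial n d g →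
                 Polynomial n (c + d) (λ x → f x + g x)
  +-polynomial (constant f≈c) (constant g≈d) = constant (λ x → +-cong (f≈c x) (g≈d x))
  +-polynomial (horner b f′ pf f≈) (horner b′ g′ pg g≈) =
    horner (b + b′) (λ x → f′ x + g′ x) (+-polynomial pf pg) λ x → begin
      _ + _                             ≈⟨ +-cong (f≈ x) (g≈ x) ⟩
      (b + x * f′ x) + (b′ + x * g′ x)  ≈⟨ solve 5 (λ b b′ x u v → (b :+ x :* u) :+ (b′ :+ x :* v)
                                                                := (b :+ b′) :+ x :* (u :+ v)) refl b b′ x (f′ x) (g′ x) ⟩
      (b + b′) + x * (f′ x + g′ x)      ∎

  division-step : ∀ {f g h : Carrier → Carrier} b r → (∀ x → f x ≈ b + x * g x) →
                  (∀ x → g x + r * h x ≈ x * h x + g r) →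
                  ∀ x → f x + r * (g r + x * h x) ≈ x * (g r + x * h x) + f r
  division-step {f} {g} {h} b r f≈ g-step x = begin
    f x + r * (g r + x * h x)           ≈⟨ +-congʳ (f≈ x) ⟩
    b + x * g x + r * (g r + x * h x)   ≈⟨ solve 6 (λ b x r gx gr hx → b :+ x :* gx :+ r :* (gr :+ x :* hx)
                                                     := (b :+ r :* gr) :+ x :* (gx :+ r :* hx)) refl b x r (g x) (g r) (h x) ⟩
    b + r * g r + x * (g x + r * h x)   ≈⟨ +-congˡ (*-congˡ (g-step x)) ⟩
    b + r * g r + x * (x * h x + g r)   ≈⟨ solve 5 (λ b x r gr hx → b :+ r :* gr :+ x :* (x :* hx :+ gr)
                                                     := x :* (gr :+ x :* hx) :+ (b :+ r :* gr)) refl b x r (g r) (h x) ⟩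
    x * (g r + x * h x) + (b + r * g r) ≈⟨ +-congˡ (f≈ r) ⟨
    x * (g r + x * h x) + f r           ∎

  -- The factor theorem, stated without subtraction: f x - f r = (x - r) h x.
  divide : ∀ {n c f} → Polynomial (ℕ.suc n) c f → ∀ r →
           ∃ λ h → Polynomial n c h × (∀ x → f x + r * h x ≈ x * h x + f r)
  divide (horner b g (constant g≈c) f≈) r =
    (λ x → g r + x * 0#) ,
    constant (λ x → trans (+-congˡ (zeroʳ x)) (trans (+-identityʳ _) (g≈c r))) ,
    division-step {h = λ _ → 0#} b r f≈ λ x → begin
      g x + r * 0#  ≈⟨ +-cong (trans (g≈c x) (sym (g≈c r))) (zeroʳ r) ⟩
      g r + 0#      ≈⟨ +-comm _ _ ⟩
      0# + g r      ≈⟨ +-congʳ (zeroʳ x) ⟨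
      x * 0# + g r  ∎
  divide (horner b g pg@(horner _ _ _ _) f≈) r with divide pg r
  ... | h , ph , g-step =
    (λ x → g r + x * h x) , horner (g r) h ph (λ _ → refl) , division-step b r f≈ g-step

  module _ (*-cancelʳ-or-zero : ∀ {x y z} → x * z ≈ y * z → x ≈ y ⊎ z ≈ 0#) where

    roots⇒leading≈0 : ∀ {n k c f} → Polynomial n c f → n ℕ.< k →
                      (ρ : Fin k → Carrier) → Injective _≡_ _≈_ ρ →
                      (∀ j → f (ρ j) ≈ 0#) → c ≈ 0#
    roots⇒leading≈0 (constant f≈c) (ℕ.s≤s _) ρ _ roots =
      trans (sym (f≈c (ρ Fin.zero))) (roots Fin.zero)
    roots⇒leading≈0 p@(horner _ _ _ _) (ℕ.s≤s n<k) ρ ρ-inj roots with divide p (ρ Fin.zero)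
    ... | h , ph , f-step =
      roots⇒leading≈0 ph n<k (λ j → ρ (Fin.suc j)) (λ eq → Finₚ.suc-injective (ρ-inj eq)) h-roots
      where
      r : Carrier
      r = ρ Fin.zero

      h-roots : ∀ j → h (ρ (Fin.suc j)) ≈ 0#
      h-roots j with *-cancelʳ-or-zero (begin
          r * h s           ≈⟨ +-identityˡ _ ⟨
          0# + r * h s      ≈⟨ +-congʳ (roots (Fin.suc j)) ⟨
          _ + r * h s       ≈⟨ f-step s ⟩
          s * h s + _       ≈⟨ +-congˡ (roots Fin.zero) ⟩
          s * h s + 0#      ≈⟨ +-identityʳ _ ⟩
          s * h s           ∎)
        where
        s : Carrier
        s = ρ (Fin.suc j)
      ... | inj₁ r≈s = ⊥-elim (Finₚ.0≢1+n (ρ-inj r≈s))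
      ... | inj₂ h≈0 = h≈0

module FiniteField {m} (K : GF2^ m) where
  open GF2^ K
  open import Algebra.Definitions.RawSemiring (Semiring.rawSemiring semiring) using (_^_)
  open import Algebra.Properties.CommutativeMonoid.Sum *-commutativeMonoid
    using (sum-remove; sum-permute; ∑-distrib-+; sum-cong-≋; sum-replicate)
    renaming (sum to ∏)
  open import Data.Fin.Permutation using (Permutation; permutation)
  open import Function.Bundles using (Surjection)
  open import Relation.Binary.Reasoning.Setoid setoid

  private
    n : ℕ.ℕ
    n = ℕ.pred (2 ℕ.^ m)

    |K|≡1+n : 2 ℕ.^ m ≡ ℕ.suc n
    |K|≡1+n = ≡.sym (ℕₚ.suc-pred (2 ℕ.^ m) {{ℕₚ.m^n≢0 2 m}})

    enumeration : Bijection (≡.setoid (Fin (ℕ.suc n))) setoid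
    enumeration = ≡.subst (λ k → Bijection (≡.setoid (Fin k)) setoid) |K|≡1+n cardinality

    enumerate : Fin (ℕ.suc n) → Carrier
    enumerate = Bijection.to enumeration

    index : Carrier → Fin (ℕ.suc n)
    index = Surjection.to⁻ (Bijection.surjection enumeration)

    enumerate-index : ∀ y → enumerate (index y) ≈ y
    enumerate-index = Surjection.to∘to⁻ (Bijection.surjection enumeration)

    index-unique : ∀ {k y} → enumerate k ≈ y → index y ≡ k
    index-unique {k} {y} eq = Bijection.injective enumeration (trans (enumerate-index y) (sym eq))

    index-cong : ∀ {x y} → x ≈ y → index x ≡ index y
    index-cong {y = y} x≈y = index-unique (trans (enumerate-index y) (sym x≈y))

    index-injective : ∀ {x y} → index x ≡ index y → x ≈ y
    index-injective {x} {y} ix≡iy = begin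
      x                   ≈⟨ enumerate-index x ⟨
      enumerate (index x) ≡⟨ ≡.cong enumerate ix≡iy ⟩
      enumerate (index y) ≈⟨ enumerate-index y ⟩
      y                   ∎

  infix 4 _≟_
  _≟_ : ∀ x y → Dec (x ≈ y)
  x ≟ y with index x Fin.≟ index y
  ... | yes ix≡iy = yes (index-injective ix≡iy)
  ... | no ix≢iy  = no (λ x≈y → ix≢iy (index-cong x≈y))

  injective⇒surjective : ∀ {f} → Congruent _≈_ _≈_ f → Injective _≈_ _≈_ f → Surjective _≈_ _≈_ f
  injective⇒surjective {f} f-cong f-inj y =
    let k , gk≡iy = Fin-injective⇒surjective g g-injective (index y)
    in enumerate k , λ z≈k → trans (f-cong z≈k) (index-injective (gk≡iy ≡.refl))
    where
    g : Fin (ℕ.suc n) → Fin (ℕ.suc n)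
    g k = index (f (enumerate k))

    g-injective : Injective _≡_ _≡_ g
    g-injective gk≡gl = Bijection.injective enumeration (f-inj (index-injective gk≡gl))

  module Transversal {σ : Carrier → Carrier} (σ-cong : Congruent _≈_ _≈_ σ)
                     (σ-involutive : ∀ x → σ (σ x) ≈ x) (σ-fixedPointFree : ∀ x → ¬ σ x ≈ x) where

    Chosen : Carrier → Set
    Chosen x = index x Fin.< index (σ x)

    -- abstract, so that `with chosen? x` can find it inside `if does (chosen? x) …`
    abstract
      chosen? : ∀ x → Dec (Chosen x)
      chosen? x = index x Fin.<? index (σ x)

    chosen-cong : ∀ {x y} → x ≈ y → Chosen x → Chosen y
    chosen-cong {x} {y} x≈y = ≡.subst₂ Fin._<_ (index-cong x≈y) (index-cong (σ-cong x≈y))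

    chosen-unique : ∀ x → Chosen x → ¬ Chosen (σ x)
    chosen-unique x x<σx σx<σσx =
      Finₚ.<-asym x<σx (≡.subst (index (σ x) Fin.<_) (index-cong (σ-involutive x)) σx<σσx)

    chosen-total : ∀ x → Chosen x ⊎ Chosen (σ x)
    chosen-total x with Finₚ.<-cmp (index x) (index (σ x))
    ... | tri< x<σx _ _ = inj₁ x<σx
    ... | tri≈ _ x≡σx _ = ⊥-elim (σ-fixedPointFree x (index-injective (≡.sym x≡σx)))
    ... | tri> _ _ σx<x = inj₂ (≡.subst (index (σ x) Fin.<_) (≡.sym (index-cong (σ-involutive x))) σx<x)

  private
    inverse-cancel : ∀ {a b} → a * b ≈ 1# → ∀ y → a * (b * y) ≈ y
    inverse-cancel {a} {b} ab≈1 y = begin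
      a * (b * y)  ≈⟨ *-assoc a b y ⟨
      (a * b) * y  ≈⟨ *-congʳ ab≈1 ⟩
      1# * y       ≈⟨ *-identityˡ y ⟩
      y            ∎

  x*y≈0⇒x≈0∨y≈0 : ∀ {x y} → x * y ≈ 0# → x ≈ 0# ⊎ y ≈ 0#
  x*y≈0⇒x≈0∨y≈0 {x} {y} xy≈0 with x ≟ 0#
  ... | yes x≈0 = inj₁ x≈0
  ... | no x≉0  = let x⁻¹ , xx⁻¹≈1 = inverse x x≉0 in inj₂ (begin
    y              ≈⟨ inverse-cancel (trans (*-comm x⁻¹ x) xx⁻¹≈1) y ⟨
    x⁻¹ * (x * y)  ≈⟨ *-congˡ xy≈0 ⟩
    x⁻¹ * 0#       ≈⟨ zeroʳ x⁻¹ ⟩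
    0#             ∎)

  *-cancelʳ : ∀ {x y z} → ¬ z ≈ 0# → x * z ≈ y * z → x ≈ y
  *-cancelʳ {x} {y} {z} z≉0 xz≈yz = let z⁻¹ , zz⁻¹≈1 = inverse z z≉0 in begin
    x              ≈⟨ *-identityʳ x ⟨
    x * 1#         ≈⟨ *-congˡ zz⁻¹≈1 ⟨
    x * (z * z⁻¹)  ≈⟨ *-assoc x z z⁻¹ ⟨
    x * z * z⁻¹    ≈⟨ *-congʳ xz≈yz ⟩
    y * z * z⁻¹    ≈⟨ *-assoc y z z⁻¹ ⟩
    y * (z * z⁻¹)  ≈⟨ *-congˡ zz⁻¹≈1 ⟩
    y * 1#         ≈⟨ *-identityʳ y ⟩
    y              ∎

  x^k≈0⇒x≈0 : ∀ {x} k → x ^ k ≈ 0# → x ≈ 0#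
  x^k≈0⇒x≈0 ℕ.zero    1≈0  = ⊥-elim (nontrivial (sym 1≈0))
  x^k≈0⇒x≈0 (ℕ.suc k) xxᵏ≈0 with x*y≈0⇒x≈0∨y≈0 xxᵏ≈0
  ... | inj₁ x≈0  = x≈0
  ... | inj₂ xᵏ≈0 = x^k≈0⇒x≈0 k xᵏ≈0

  private
    -- Replacing 0 by 1 turns the product over all of K into the product over K*.
    unit : Carrier → Carrier
    unit y = if does (y ≟ 0#) then 1# else y

    unit-cong : ∀ {y y′} → y ≈ y′ → unit y ≈ unit y′
    unit-cong {y} {y′} y≈y′ with y ≟ 0# | y′ ≟ 0#
    ... | yes _   | yes _    = refl
    ... | no _    | no _     = y≈y′
    ... | yes y≈0 | no y′≉0  = ⊥-elim (y′≉0 (trans (sym y≈y′) y≈0))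
    ... | no y≉0  | yes y′≈0 = ⊥-elim (y≉0 (trans y≈y′ y′≈0))

    unit≉0 : ∀ y → ¬ unit y ≈ 0#
    unit≉0 y with y ≟ 0#
    ... | yes _  = λ 1≈0 → nontrivial (sym 1≈0)
    ... | no y≉0 = y≉0

    ∏-unit≉0 : ∀ {k} (f : Fin k → Carrier) → ¬ ∏ (λ j → unit (f j)) ≈ 0#
    ∏-unit≉0 {ℕ.zero}  f 1≈0 = nontrivial (sym 1≈0)
    ∏-unit≉0 {ℕ.suc k} f ∏≈0 with x*y≈0⇒x≈0∨y≈0 ∏≈0
    ... | inj₁ head≈0 = unit≉0 (f Fin.zero) head≈0
    ... | inj₂ tail≈0 = ∏-unit≉0 (λ j → f (Fin.suc j)) tail≈0

  module _ {x} (x≉0 : ¬ x ≈ 0#) where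
    private
      x⁻¹ : Carrier
      x⁻¹ = proj₁ (inverse x x≉0)

      xx⁻¹≈1 : x * x⁻¹ ≈ 1#
      xx⁻¹≈1 = proj₂ (inverse x x≉0)

      x⁻¹x≈1 : x⁻¹ * x ≈ 1#
      x⁻¹x≈1 = trans (*-comm x⁻¹ x) xx⁻¹≈1

      factor : Carrier → Carrier
      factor y = if does (y ≟ 0#) then 1# else x

      unit-* : ∀ y → unit (x * y) ≈ factor y * unit y
      unit-* y with y ≟ 0# | x * y ≟ 0#
      ... | yes _   | yes _    = sym (*-identityˡ 1#)
      ... | no _    | no _     = refl
      ... | yes y≈0 | no xy≉0  = ⊥-elim (xy≉0 (trans (*-congˡ y≈0) (zeroʳ x)))
      ... | no y≉0  | yes xy≈0 with x*y≈0⇒x≈0∨y≈0 xy≈0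
      ...   | inj₁ x≈0 = ⊥-elim (x≉0 x≈0)
      ...   | inj₂ y≈0 = ⊥-elim (y≉0 y≈0)

      scaling : Permutation (ℕ.suc n) (ℕ.suc n)
      scaling = permutation (λ k → index (x * enumerate k)) (λ k → index (x⁻¹ * enumerate k))
        (λ k → index-unique (sym (trans (*-congˡ (enumerate-index _)) (inverse-cancel xx⁻¹≈1 _))))
        (λ k → index-unique (sym (trans (*-congˡ (enumerate-index _)) (inverse-cancel x⁻¹x≈1 _))))

      ∏-factor : ∏ (λ k → factor (enumerate k)) ≈ x ^ n
      ∏-factor = begin
        ∏ (λ k → factor (enumerate k))
          ≈⟨ sum-remove {i = z} (λ k → factor (enumerate k)) ⟩
        factor (enumerate z) * ∏ (λ k → factor (enumerate (Fin.punchIn z k)))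
          ≈⟨ *-cong factor-at-0 (sum-cong-≋ {n} factor-elsewhere) ⟩
        1# * ∏ {n} (λ _ → x)
          ≈⟨ *-identityˡ _ ⟩
        ∏ {n} (λ _ → x)
          ≈⟨ sum-replicate n {x} ⟩
        x ^ n
          ∎
        where
        z : Fin (ℕ.suc n)
        z = index 0#

        factor-at-0 : factor (enumerate z) ≈ 1#
        factor-at-0 with enumerate z ≟ 0#
        ... | yes _   = refl
        ... | no ez≉0 = ⊥-elim (ez≉0 (enumerate-index 0#))

        factor-elsewhere : ∀ k → factor (enumerate (Fin.punchIn z k)) ≈ x
        factor-elsewhere k with enumerate (Fin.punchIn z k) ≟ 0#
        ... | yes e≈0 = ⊥-elim (Finₚ.punchInᵢ≢i z k (≡.sym (index-unique e≈0)))
        ... | no _    = refl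

    x^n≈1 : x ^ n ≈ 1#
    x^n≈1 = *-cancelʳ (∏-unit≉0 enumerate) (begin
      x ^ n * P
        ≈⟨ *-congʳ ∏-factor ⟨
      ∏ (λ k → factor (enumerate k)) * P
        ≈⟨ ∑-distrib-+ (λ k → factor (enumerate k)) (λ k → unit (enumerate k)) ⟨
      ∏ (λ k → factor (enumerate k) * unit (enumerate k))
        ≈⟨ sum-cong-≋ (λ k → unit-* (enumerate k)) ⟨
      ∏ (λ k → unit (x * enumerate k))
        ≈⟨ sum-cong-≋ (λ k → unit-cong (enumerate-index (x * enumerate k))) ⟨
      ∏ (λ k → unit (enumerate (index (x * enumerate k))))
        ≈⟨ sum-permute (λ k → unit (enumerate k)) scaling ⟨
      P
        ≈⟨ *-identityˡ P ⟨
      1# * P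
        ∎)
      where
      P : Carrier
      P = ∏ (λ k → unit (enumerate k))

  fermat : ∀ x → x ^ (2 ℕ.^ m) ≈ x
  fermat x rewrite |K|≡1+n with x ≟ 0#
  ... | yes x≈0 = trans (*-congʳ x≈0) (trans (zeroˡ _) (sym x≈0))
  ... | no x≉0  = trans (*-congˡ (x^n≈1 x≉0)) (*-identityʳ x)

  *-cancelʳ-or-zero : ∀ {x y z} → x * z ≈ y * z → x ≈ y ⊎ z ≈ 0#
  *-cancelʳ-or-zero {z = z} xz≈yz with z ≟ 0#
  ... | yes z≈0 = inj₂ z≈0
  ... | no z≉0  = inj₁ (*-cancelʳ z≉0 xz≈yz)

module BinaryField {m} (K : GF2^ (ℕ.suc m)) where
  open GF2^ K
  open FiniteField K public
  open import Algebra.Definitions.RawSemiring (Semiring.rawSemiring semiring) using (_^_)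
  open import Algebra.Properties.Ring ring using (-1*x≈-x; -‿involutive)
  open import Algebra.Properties.Semiring.Exp semiring using (^-congˡ; ^-assocʳ)
  open import Algebra.Properties.CommutativeSemigroup +-commutativeSemigroup
    using () renaming (interchange to +-interchange; xy∙z≈xz∙y to +-xy∙z≈xz∙y)
  open import Algebra.Properties.Group +-group using () renaming (∙-cancelʳ to +-cancelʳ)
  open import Relation.Binary.Reasoning.Setoid setoid

  1+1≈0 : 1# + 1# ≈ 0#
  1+1≈0 = trans (+-congʳ 1≈-1) (-‿inverseˡ 1#)
    where
    1^k≈1 : ∀ k → 1# ^ k ≈ 1#
    1^k≈1 ℕ.zero    = refl
    1^k≈1 (ℕ.suc k) = trans (*-identityˡ _) (1^k≈1 k)

    [-1]²≈1 : (- 1#) ^ 2 ≈ 1#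
    [-1]²≈1 = trans (*-congˡ (*-identityʳ _)) (trans (-1*x≈-x (- 1#)) (-‿involutive 1#))

    1≈-1 : 1# ≈ - 1#
    1≈-1 = begin
      1#                        ≈⟨ 1^k≈1 (2 ℕ.^ m) ⟨
      1# ^ (2 ℕ.^ m)            ≈⟨ ^-congˡ (2 ℕ.^ m) [-1]²≈1 ⟨
      ((- 1#) ^ 2) ^ (2 ℕ.^ m)  ≈⟨ ^-assocʳ (- 1#) 2 (2 ℕ.^ m) ⟩
      (- 1#) ^ (2 ℕ.^ ℕ.suc m)  ≈⟨ fermat (- 1#) ⟩
      - 1#                      ∎

  open Characteristic.Two commRing 1+1≈0 public

  pow≡^ : ∀ x k → pow K x k ≡ x ^ k
  pow≡^ x ℕ.zero    = ≡.refl
  pow≡^ x (ℕ.suc k) = ≡.cong (x *_) (pow≡^ x k)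

  frobenius-injective : ∀ k {x y} → x ^ (2 ℕ.^ k) ≈ y ^ (2 ℕ.^ k) → x ≈ y
  frobenius-injective k {x} {y} xᵠ≈yᵠ =
    x+y≈0⇒x≈y (x^k≈0⇒x≈0 (2 ℕ.^ k) (trans (frobenius-+ k x y) (x≈y⇒x+y≈0 xᵠ≈yᵠ)))

  frobenius-∘ : ∀ a b x → (x ^ (2 ℕ.^ a)) ^ (2 ℕ.^ b) ≈ x ^ (2 ℕ.^ (a ℕ.+ b))
  frobenius-∘ a b x = trans (^-assocʳ x (2 ℕ.^ a) (2 ℕ.^ b))
                            (reflexive (≡.cong (x ^_) (≡.sym (ℕₚ.^-distribˡ-+-* 2 a b))))

  FrobeniusFixed : ℕ.ℕ → Carrier → Set
  FrobeniusFixed j d = d ^ (2 ℕ.^ j) ≈ d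

  fixed-+ : ∀ {a b d} → FrobeniusFixed a d → FrobeniusFixed b d → FrobeniusFixed (a ℕ.+ b) d
  fixed-+ {a} {b} {d} fixedᵃ fixedᵇ = begin
    d ^ (2 ℕ.^ (a ℕ.+ b))        ≈⟨ frobenius-∘ a b d ⟨
    (d ^ (2 ℕ.^ a)) ^ (2 ℕ.^ b)  ≈⟨ ^-congˡ (2 ℕ.^ b) fixedᵃ ⟩
    d ^ (2 ℕ.^ b)                ≈⟨ fixedᵇ ⟩
    d                            ∎

  fixed-* : ∀ {a d} → FrobeniusFixed a d → ∀ k → FrobeniusFixed (k ℕ.* a) d
  fixed-* {d = d} fixedᵃ ℕ.zero    = *-identityʳ d
  fixed-* {a}     fixedᵃ (ℕ.suc k) = fixed-+ {a} {k ℕ.* a} fixedᵃ (fixed-* fixedᵃ k)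

  fixed-cancelʳ : ∀ {a b d} → FrobeniusFixed (a ℕ.+ b) d → FrobeniusFixed b d → FrobeniusFixed a d
  fixed-cancelʳ {a} {b} {d} fixedᵃ⁺ᵇ fixedᵇ = frobenius-injective b (begin
    (d ^ (2 ℕ.^ a)) ^ (2 ℕ.^ b)  ≈⟨ frobenius-∘ a b d ⟩
    d ^ (2 ℕ.^ (a ℕ.+ b))        ≈⟨ fixedᵃ⁺ᵇ ⟩
    d                            ≈⟨ fixedᵇ ⟨
    d ^ (2 ℕ.^ b)                ∎)

  fixed-gcd : ∀ {a b d} → FrobeniusFixed a d → FrobeniusFixed b d → FrobeniusFixed (gcd a b) d
  fixed-gcd {a} {b} {d} fixedᵃ fixedᵇ with Bézout.identity (gcd-GCD a b)
  ... | Bézout.+- x y g+yb≡xa = fixed-cancelʳ {gcd a b} {y ℕ.* b}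
          (≡.subst (λ j → FrobeniusFixed j d) (≡.sym g+yb≡xa) (fixed-* fixedᵃ x)) (fixed-* fixedᵇ y)
  ... | Bézout.-+ x y g+xa≡yb = fixed-cancelʳ {gcd a b} {x ℕ.* a}
          (≡.subst (λ j → FrobeniusFixed j d) (≡.sym g+xa≡yb) (fixed-* fixedᵇ y)) (fixed-* fixedᵃ x)

  fixed-1 : ∀ {d} → FrobeniusFixed 1 d → d ≈ 0# ⊎ d ≈ 1#
  fixed-1 {d} d²≈d with x*y≈0⇒x≈0∨y≈0 {d} {d + 1#} (begin
    d * (d + 1#)      ≈⟨ distribˡ d d 1# ⟩
    d * d + d * 1#    ≈⟨ +-congˡ (*-identityʳ d) ⟩
    d * d + d         ≈⟨ x≈y⇒x+y≈0 (trans (*-congˡ (sym (*-identityʳ d))) d²≈d) ⟩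
    0#                ∎)
  ... | inj₁ d≈0   = inj₁ d≈0
  ... | inj₂ d+1≈0 = inj₂ (x+y≈0⇒x≈y d+1≈0)

  trSum-step : ∀ n x → trSum K (ℕ.suc n) x ≈ trSum K n x + x ^ (2 ℕ.^ n)
  trSum-step n x = +-congˡ (reflexive (pow≡^ x (2 ℕ.^ n)))

  trSum-cong : ∀ n {x y} → x ≈ y → trSum K n x ≈ trSum K n y
  trSum-cong ℕ.zero    x≈y = refl
  trSum-cong (ℕ.suc n) {x} {y} x≈y = begin
    trSum K (ℕ.suc n) x             ≈⟨ trSum-step n x ⟩
    trSum K n x + x ^ (2 ℕ.^ n)     ≈⟨ +-cong (trSum-cong n x≈y) (^-congˡ (2 ℕ.^ n) x≈y) ⟩
    trSum K n y + y ^ (2 ℕ.^ n)     ≈⟨ trSum-step n y ⟨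
    trSum K (ℕ.suc n) y             ∎

  trSum-+ : ∀ n x y → trSum K n (x + y) ≈ trSum K n x + trSum K n y
  trSum-+ ℕ.zero    x y = sym (+-identityʳ 0#)
  trSum-+ (ℕ.suc n) x y = begin
    trSum K (ℕ.suc n) (x + y)                                    ≈⟨ trSum-step n (x + y) ⟩
    trSum K n (x + y) + (x + y) ^ (2 ℕ.^ n)                      ≈⟨ +-cong (trSum-+ n x y) (frobenius-+ n x y) ⟩
    (trSum K n x + trSum K n y) + (x ^ (2 ℕ.^ n) + y ^ (2 ℕ.^ n)) ≈⟨ +-interchange _ _ _ _ ⟩
    (trSum K n x + x ^ (2 ℕ.^ n)) + (trSum K n y + y ^ (2 ℕ.^ n)) ≈⟨ +-cong (trSum-step n x) (trSum-step n y) ⟨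
    trSum K (ℕ.suc n) x + trSum K (ℕ.suc n) y                    ∎

  trSum-square : ∀ n x → trSum K n (x ^ 2) + x ≈ trSum K n x + x ^ (2 ℕ.^ n)
  trSum-square ℕ.zero    x = +-congˡ (sym (*-identityʳ x))
  trSum-square (ℕ.suc n) x = begin
    trSum K (ℕ.suc n) (x ^ 2) + x                           ≈⟨ +-congʳ (trSum-step n (x ^ 2)) ⟩
    (trSum K n (x ^ 2) + (x ^ 2) ^ (2 ℕ.^ n)) + x           ≈⟨ +-xy∙z≈xz∙y _ _ _ ⟩
    (trSum K n (x ^ 2) + x) + (x ^ 2) ^ (2 ℕ.^ n)           ≈⟨ +-cong (trSum-square n x) (^-assocʳ x 2 (2 ℕ.^ n)) ⟩
    (trSum K n x + x ^ (2 ℕ.^ n)) + x ^ (2 ℕ.^ ℕ.suc n)     ≈⟨ +-congʳ (trSum-step n x) ⟨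
    trSum K (ℕ.suc n) x + x ^ (2 ℕ.^ ℕ.suc n)               ∎

  tr-cong : ∀ {x y} → x ≈ y → tr K x ≈ tr K y
  tr-cong = trSum-cong (ℕ.suc m)

  tr-+ : ∀ x y → tr K (x + y) ≈ tr K x + tr K y
  tr-+ = trSum-+ (ℕ.suc m)

  tr-square : ∀ x → tr K (x ^ 2) ≈ tr K x
  tr-square x = +-cancelʳ x _ _ (trans (trSum-square (ℕ.suc m) x) (+-congˡ (fermat x)))

  tr-frobenius : ∀ k x → tr K (x ^ (2 ℕ.^ k)) ≈ tr K x
  tr-frobenius ℕ.zero    x = tr-cong (*-identityʳ x)
  tr-frobenius (ℕ.suc k) x = begin
    tr K (x ^ (2 ℕ.^ ℕ.suc k))      ≈⟨ tr-cong (^-assocʳ x 2 (2 ℕ.^ k)) ⟨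
    tr K ((x ^ 2) ^ (2 ℕ.^ k))      ≈⟨ tr-frobenius k (x ^ 2) ⟩
    tr K (x ^ 2)                    ≈⟨ tr-square x ⟩
    tr K x                          ∎

  open Polynomial commutativeSemiring
    using (Polynomial; constant; Polynomial-cong; raise; raise-≤′; ^-polynomial; +-polynomial; roots⇒leading≈0)

  private
    2^-<-suc : ∀ n → 2 ℕ.^ n ℕ.< 2 ℕ.^ ℕ.suc n
    2^-<-suc n = ℕₚ.^-monoʳ-< 2 (ℕₚ.n<1+n 1) (ℕₚ.n<1+n n)

  trSum-polynomial : ∀ n → Polynomial (2 ℕ.^ n) 0# (trSum K n)
  trSum-polynomial ℕ.zero    = raise (constant (λ _ → refl))
  trSum-polynomial (ℕ.suc n) = Polynomial-cong (λ x → sym (trSum-step n x))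
    (raise-≤′ (ℕₚ.≤⇒≤′ (2^-<-suc n))
      (raise (+-polynomial (trSum-polynomial n) (^-polynomial (2 ℕ.^ n)))))

  tr-polynomial : Polynomial (2 ℕ.^ m) (0# + 1#) (tr K)
  tr-polynomial = Polynomial-cong (λ x → sym (trSum-step m x))
    (+-polynomial (trSum-polynomial m) (^-polynomial (2 ℕ.^ m)))

  trace-nonzero : ∃ λ δ → ¬ tr K δ ≈ 0#
  trace-nonzero =
    let k , trₖ≉0 = Finₚ.¬∀⟶∃¬ _ (λ k → tr K (element k) ≈ 0#) (λ k → tr K (element k) ≟ 0#)
                                 not-all
    in element k , trₖ≉0
    where
    element : Fin (2 ℕ.^ ℕ.suc m) → Carrier
    element = Bijection.to cardinality

    not-all : ¬ (∀ k → tr K (element k) ≈ 0#)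
    not-all all-zero = nontrivial (sym (trans (sym (+-identityˡ 1#))
      (roots⇒leading≈0 *-cancelʳ-or-zero tr-polynomial (2^-<-suc m)
        element (Bijection.injective cardinality) all-zero)))

module ArtinSchreier {m} (K : GF2^ (ℕ.suc m)) (i : ℕ.ℕ) (m+1⊥i : gcd (ℕ.suc m) i ≡ 1) where
  open GF2^ K
  open BinaryField K
  open import Algebra.Definitions.RawSemiring (Semiring.rawSemiring semiring) using (_^_)
  open import Algebra.Properties.Semiring.Exp semiring using (^-congˡ)
  open import Algebra.Properties.CommutativeSemigroup +-commutativeSemigroup
    using () renaming (interchange to +-interchange)
  open import Algebra.Properties.Group +-group using () renaming (∙-cancelʳ to +-cancelʳ)
  open import Relation.Binary.Reasoning.Setoid setoid

  ℘ : Carrier → Carrier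
  ℘ w = w ^ (2 ℕ.^ i) + w

  ℘-cong : ∀ {x y} → x ≈ y → ℘ x ≈ ℘ y
  ℘-cong x≈y = +-cong (^-congˡ (2 ℕ.^ i) x≈y) x≈y

  ℘-+ : ∀ x y → ℘ (x + y) ≈ ℘ x + ℘ y
  ℘-+ x y = trans (+-congʳ (frobenius-+ i x y)) (+-interchange _ _ _ _)

  tr-℘ : ∀ w → tr K (℘ w) ≈ 0#
  tr-℘ w = begin
    tr K (w ^ (2 ℕ.^ i) + w)          ≈⟨ tr-+ _ w ⟩
    tr K (w ^ (2 ℕ.^ i)) + tr K w     ≈⟨ +-congʳ (tr-frobenius i w) ⟩
    tr K w + tr K w                   ≈⟨ x+x≈0 (tr K w) ⟩
    0#                                ∎

  ℘≈0 : ∀ {d} → ℘ d ≈ 0# → d ≈ 0# ⊎ d ≈ 1#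
  ℘≈0 {d} ℘d≈0 = fixed-1 (≡.subst (λ j → FrobeniusFixed j d) m+1⊥i
    (fixed-gcd {ℕ.suc m} {i} (fermat d) (x+y≈0⇒x≈y ℘d≈0)))

  ℘-fibre : ∀ {x y} → ℘ x ≈ ℘ y → x ≈ y ⊎ x ≈ y + 1#
  ℘-fibre {x} {y} ℘x≈℘y with ℘≈0 (trans (℘-+ x y) (x≈y⇒x+y≈0 ℘x≈℘y))
  ... | inj₁ x+y≈0 = inj₁ (x+y≈0⇒x≈y x+y≈0)
  ... | inj₂ x+y≈1 = inj₂ (trans (sym (x+y+y≈x x y)) (trans (+-congʳ x+y≈1) (+-comm 1# y)))

  private
    δ : Carrier
    δ = proj₁ trace-nonzero

    trδ≉0 : ¬ tr K δ ≈ 0#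
    trδ≉0 = proj₂ trace-nonzero

    +1-fixedPointFree : ∀ x → ¬ x + 1# ≈ x
    +1-fixedPointFree x x+1≈x = nontrivial (sym (begin
      1#                ≈⟨ x+y+y≈x 1# x ⟨
      1# + x + x        ≈⟨ +-congʳ (+-comm 1# x) ⟩
      x + 1# + x        ≈⟨ x≈y⇒x+y≈0 x+1≈x ⟩
      0#                ∎))

    open Transversal {σ = _+ 1#} +-congʳ (λ x → x+y+y≈x x 1#) +1-fixedPointFree

    trace-zero≉℘+δ : ∀ {a} y → tr K a ≈ 0# → ¬ a ≈ ℘ y + δ
    trace-zero≉℘+δ {a} y tra≈0 a≈℘y+δ = trδ≉0 (begin
      tr K δ                  ≈⟨ +-identityˡ _ ⟨
      0# + tr K δ             ≈⟨ +-congʳ (tr-℘ y) ⟨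
      tr K (℘ y) + tr K δ     ≈⟨ tr-+ (℘ y) δ ⟨
      tr K (℘ y + δ)          ≈⟨ tr-cong a≈℘y+δ ⟨
      tr K a                  ≈⟨ tra≈0 ⟩
      0#                      ∎)

    -- ℘ is two-to-one; moving its values at the non-chosen points off the
    -- trace-zero hyperplane makes it injective, hence surjective.
    ℘′ : Carrier → Carrier
    ℘′ w = if does (chosen? w) then ℘ w else ℘ w + δ

    ℘′-cong : Congruent _≈_ _≈_ ℘′
    ℘′-cong {x} {y} x≈y with chosen? x | chosen? y
    ... | yes _  | yes _  = ℘-cong x≈y
    ... | no _   | no _   = +-congʳ (℘-cong x≈y)
    ... | yes cx | no ¬cy = ⊥-elim (¬cy (chosen-cong x≈y cx))
    ... | no ¬cx | yes cy = ⊥-elim (¬cx (chosen-cong (sym x≈y) cy))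

    ℘′-injective : Injective _≈_ _≈_ ℘′
    ℘′-injective {x} {y} ℘′x≈℘′y with chosen? x | chosen? y
    ... | yes _  | no _   = ⊥-elim (trace-zero≉℘+δ y (tr-℘ x) ℘′x≈℘′y)
    ... | no _   | yes _  = ⊥-elim (trace-zero≉℘+δ x (tr-℘ y) (sym ℘′x≈℘′y))
    ... | yes cx | yes cy with ℘-fibre ℘′x≈℘′y
    ...   | inj₁ x≈y   = x≈y
    ...   | inj₂ x≈y+1 = ⊥-elim (chosen-unique y cy (chosen-cong x≈y+1 cx))
    ℘′-injective {x} {y} ℘′x≈℘′y | no ¬cx | no ¬cy with ℘-fibre (+-cancelʳ δ _ _ ℘′x≈℘′y)
    ...   | inj₁ x≈y   = x≈y
    ...   | inj₂ x≈y+1 with chosen-total y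
    ...     | inj₁ cy   = ⊥-elim (¬cy cy)
    ...     | inj₂ cy+1 = ⊥-elim (¬cx (chosen-cong (sym x≈y+1) cy+1))

  ℘-onto-trace-zero : ∀ {a} → tr K a ≈ 0# → ∃ λ w → ℘ w ≈ a
  ℘-onto-trace-zero {a} tra≈0 =
    let w , ℘′w≈a = injective⇒surjective ℘′-cong ℘′-injective a in w , unshift w (℘′w≈a refl)
    where
    unshift : ∀ w → ℘′ w ≈ a → ℘ w ≈ a
    unshift w ℘′w≈a with chosen? w
    ... | yes _ = ℘′w≈a
    ... | no _  = ⊥-elim (trace-zero≉℘+δ w tra≈0 (sym ℘′w≈a))

module PermutationCriterion {m} (K : GF2^ (ℕ.suc m)) (i : ℕ.ℕ) (m+1⊥i : gcd (ℕ.suc m) i ≡ 1)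
  (L L′ : GF2^.Carrier K → GF2^.Carrier K) (L-linear : F2Linear K L) (L′-linear : F2Linear K L′) where
  open GF2^ K
  open BinaryField K
  open ArtinSchreier K i m+1⊥i
  open import Algebra.Definitions.RawSemiring (Semiring.rawSemiring semiring) using (_^_)
  open import Algebra.Properties.Semiring.Exp semiring using (^-congˡ; ^-homo-*)
  open import Algebra.Properties.CommutativeSemiring.Exp commutativeSemiring using (^-distrib-*)
  open import Algebra.Properties.CommutativeSemigroup +-commutativeSemigroup
    using () renaming (interchange to +-interchange)
  open import Algebra.Solver.Ring.NaturalCoefficients.Default commutativeSemiring
  open import Relation.Binary.Reasoning.Setoid setoid
  module L = F2Linear L-linear
  module L′ = F2Linear L′-linear

  q : ℕ.ℕ
  q = 2 ℕ.^ i

  F : Carrier → Carrier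
  F x = L (pow K x (q ℕ.+ 1)) + L′ x

  Condition : Set
  Condition = ∀ u v → ¬ u ≈ 0# → tr K v ≈ tr K 1# → ¬ L (pow K u (q ℕ.+ 1) * v) ≈ L′ u

  private
    pow≈^ : ∀ x k → pow K x k ≈ x ^ k
    pow≈^ x k = reflexive (pow≡^ x k)

    ^q+1 : ∀ x → x ^ (q ℕ.+ 1) ≈ x ^ q * x
    ^q+1 x = trans (^-homo-* x q 1) (*-congˡ (*-identityʳ x))

  F-cong : Congruent _≈_ _≈_ F
  F-cong {x} {y} x≈y = +-cong (L.cong xᵠ⁺¹≈yᵠ⁺¹) (L′.cong x≈y)
    where
    xᵠ⁺¹≈yᵠ⁺¹ : pow K x (q ℕ.+ 1) ≈ pow K y (q ℕ.+ 1)
    xᵠ⁺¹≈yᵠ⁺¹ = trans (pow≈^ x (q ℕ.+ 1)) (trans (^-congˡ (q ℕ.+ 1) x≈y) (sym (pow≈^ y (q ℕ.+ 1))))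

  power-difference : ∀ u w → (u * w + u) ^ (q ℕ.+ 1) + (u * w) ^ (q ℕ.+ 1) ≈ u ^ (q ℕ.+ 1) * (℘ w + 1#)
  power-difference u w = begin
    (u * w + u) ^ (q ℕ.+ 1) + (u * w) ^ (q ℕ.+ 1)
      ≈⟨ +-cong (^q+1 _) (^q+1 _) ⟩
    (u * w + u) ^ q * (u * w + u) + (u * w) ^ q * (u * w)
      ≈⟨ +-cong (*-congʳ (trans (frobenius-+ i _ _) (+-congʳ (^-distrib-* u w q))))
                (*-congʳ (^-distrib-* u w q)) ⟩
    (U * W + U) * (u * w + u) + U * W * (u * w)
      ≈⟨ solve 4 (λ U W u w → (U :* W :+ U) :* (u :* w :+ u) :+ U :* W :* (u :* w)
                   := U :* u :* (W :+ w :+ con 1) :+ (U :* W :* (u :* w) :+ U :* W :* (u :* w)))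
                 refl U W u w ⟩
    U * u * (W + w + 1#) + (U * W * (u * w) + U * W * (u * w))
      ≈⟨ +-congˡ (x+x≈0 _) ⟩
    U * u * (W + w + 1#) + 0#
      ≈⟨ +-identityʳ _ ⟩
    U * u * (W + w + 1#)
      ≈⟨ *-congʳ (^q+1 u) ⟨
    u ^ (q ℕ.+ 1) * (℘ w + 1#)
      ∎
    where
    U W : Carrier
    U = u ^ q
    W = w ^ q

  F-difference : ∀ u w → F (u * w + u) + F (u * w) ≈ L (pow K u (q ℕ.+ 1) * (℘ w + 1#)) + L′ u
  F-difference u w = begin
    (L (pow K y (q ℕ.+ 1)) + L′ y) + (L (pow K x (q ℕ.+ 1)) + L′ x)  ≈⟨ +-interchange _ _ _ _ ⟩
    (L (pow K y (q ℕ.+ 1)) + L (pow K x (q ℕ.+ 1))) + (L′ y + L′ x)  ≈⟨ +-cong (L.additive _ _) (L′.additive y x) ⟨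
    L (pow K y (q ℕ.+ 1) + pow K x (q ℕ.+ 1)) + L′ (y + x)          ≈⟨ +-cong (L.cong powers) (L′.cong y+x≈u) ⟩
    L (pow K u (q ℕ.+ 1) * (℘ w + 1#)) + L′ u                      ∎
    where
    x y : Carrier
    x = u * w
    y = u * w + u

    y+x≈u : y + x ≈ u
    y+x≈u = trans (+-congʳ (+-comm x u)) (x+y+y≈x u x)

    powers : pow K y (q ℕ.+ 1) + pow K x (q ℕ.+ 1) ≈ pow K u (q ℕ.+ 1) * (℘ w + 1#)
    powers = trans (+-cong (pow≈^ y (q ℕ.+ 1)) (pow≈^ x (q ℕ.+ 1)))
                   (trans (power-difference u w) (*-congʳ (sym (pow≈^ u (q ℕ.+ 1)))))

  F-bijective⇒condition : Bijective _≈_ _≈_ F → Condition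
  F-bijective⇒condition (F-injective , _) u v u≉0 trv≈tr1 Luᵠv≈L′u = u≉0 u≈0
    where
    solution : ∃ λ w → ℘ w ≈ v + 1#
    solution = ℘-onto-trace-zero (trans (tr-+ v 1#) (x≈y⇒x+y≈0 trv≈tr1))

    w : Carrier
    w = proj₁ solution

    ℘w+1≈v : ℘ w + 1# ≈ v
    ℘w+1≈v = trans (+-congʳ (proj₂ solution)) (x+y+y≈x v 1#)

    collision : F (u * w + u) ≈ F (u * w)
    collision = x+y≈0⇒x≈y (begin
      F (u * w + u) + F (u * w)                    ≈⟨ F-difference u w ⟩
      L (pow K u (q ℕ.+ 1) * (℘ w + 1#)) + L′ u    ≈⟨ +-congʳ (L.cong (*-congˡ ℘w+1≈v)) ⟩
      L (pow K u (q ℕ.+ 1) * v) + L′ u             ≈⟨ x≈y⇒x+y≈0 Luᵠv≈L′u ⟩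
      0#                                           ∎)

    u≈0 : u ≈ 0#
    u≈0 = begin
      u                   ≈⟨ x+y+y≈x u (u * w) ⟨
      u + u * w + u * w   ≈⟨ +-congʳ (+-comm u (u * w)) ⟩
      u * w + u + u * w   ≈⟨ x≈y⇒x+y≈0 (F-injective collision) ⟩
      0#                  ∎

  condition⇒F-bijective : Condition → Bijective _≈_ _≈_ F
  condition⇒F-bijective condition = F-injective , injective⇒surjective F-cong F-injective
    where
    F-injective : Injective _≈_ _≈_ F
    F-injective {x} {y} Fx≈Fy with x ≟ y
    ... | yes x≈y = x≈y
    ... | no x≉y  = ⊥-elim (condition u (℘ w + 1#) u≉0 tr[℘w+1]≈tr1 Luᵠv≈L′u)
      where
      u : Carrier
      u = x + y

      u≉0 : ¬ u ≈ 0#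
      u≉0 u≈0 = x≉y (x+y≈0⇒x≈y u≈0)

      w : Carrier
      w = proj₁ (inverse u u≉0) * x

      uw≈x : u * w ≈ x
      uw≈x = trans (sym (*-assoc u _ x)) (trans (*-congʳ (proj₂ (inverse u u≉0))) (*-identityˡ x))

      uw+u≈y : u * w + u ≈ y
      uw+u≈y = begin
        u * w + u        ≈⟨ +-congʳ uw≈x ⟩
        x + (x + y)      ≈⟨ +-comm x (x + y) ⟩
        x + y + x        ≈⟨ +-congʳ (+-comm x y) ⟩
        y + x + x        ≈⟨ x+y+y≈x y x ⟩
        y                ∎

      tr[℘w+1]≈tr1 : tr K (℘ w + 1#) ≈ tr K 1#
      tr[℘w+1]≈tr1 = trans (tr-+ (℘ w) 1#) (trans (+-congʳ (tr-℘ w)) (+-identityˡ _))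

      Luᵠv≈L′u : L (pow K u (q ℕ.+ 1) * (℘ w + 1#)) ≈ L′ u
      Luᵠv≈L′u = x+y≈0⇒x≈y (begin
        L (pow K u (q ℕ.+ 1) * (℘ w + 1#)) + L′ u  ≈⟨ F-difference u w ⟨
        F (u * w + u) + F (u * w)                  ≈⟨ +-cong (F-cong uw+u≈y) (F-cong uw≈x) ⟩
        F y + F x                                  ≈⟨ x≈y⇒x+y≈0 (sym Fx≈Fy) ⟩
        0#                                         ∎)

  criterion : Bijective _≈_ _≈_ F ⇔ Condition
  criterion = mk⇔ F-bijective⇒condition condition⇒F-bijective

GF2^0-empty : ¬ GF2^ 0
GF2^0-empty K with Bijection.surjective (GF2^.cardinality K) (GF2^.0# K)
                 | Bijection.surjective (GF2^.cardinality K) (GF2^.1# K)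
... | Fin.zero , ↦0 | Fin.zero , ↦1 = GF2^.nontrivial K (GF2^.trans K (GF2^.sym K (↦0 ≡.refl)) (↦1 ≡.refl))

open import Data.Nat using (ℕ; _≤_; _^_; _+_)

proposition5 : (m i : ℕ) (K : GF2^ m) → 1 ≤ i → gcd m i ≡ 1 →
    (L L′ : GF2^.Carrier K → GF2^.Carrier K) →
    F2Linear K L → F2Linear K L′ →
    Bijective (GF2^._≈_ K) (GF2^._≈_ K)
      (λ x → GF2^._+_ K (L (pow K x (2 ^ i + 1))) (L′ x))
    ⇔
    (∀ u v → ¬ (GF2^._≈_ K u (GF2^.0# K)) →
      GF2^._≈_ K (tr K v) (tr K (GF2^.1# K)) →
      ¬ (GF2^._≈_ K (L (GF2^._*_ K (pow K u (2 ^ i + 1)) v)) (L′ u)))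
proposition5 ℕ.zero      i K _ _       L L′ _ _ = ⊥-elim (GF2^0-empty K)
proposition5 (ℕ.suc m) i K _ m+1⊥i L L′ L-linear L′-linear =
  PermutationCriterion.criterion K i m+1⊥i L L′ L-linear L′-linear
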